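{- For every permutation $\pi$ in the domain of the respective operator, $\psi_p(\pi)$, $\psi_q(\pi)$ and $\psi_s(\pi)$ each have the same number of recoils as $\pi$, and $\psi_r(\pi)$ has exactly one more recoil than $\pi$.
   Context: Permutations are in one-line form $[\pi_1\cdots\pi_n]$; $S_0$ consists of the empty permutation $e_0$, and $e_n=[1\,2\cdots n]$. A recoil of $\pi\in S_n$ is a value $i\in\{1,\dots,n-1\}$ such that $i$ occurs after $i+1$ in $\pi$. A permutation is evil-avoiding if it avoids each of $2413, 4132, 4213, 3214$. For $\pi\in S_n$, $1\le i,j\le n+1$, $\rho_{i,j}(\pi)\in S_{n+1}$ increases by $1$ every entry $\ge i$ and inserts the value $i$ at position $j$. $\mathbb{1}_S$ is $1$ if $S$ holds, else $0$. Operators: $\psi_p=\rho_{1,1}$, with domain the evil-avoiding permutations that are not an identity $e_n$ ($n\ge0$). $\psi_q$, with domain the evil-avoiding non-identity $\pi\in S_n$: let $t$ be the least $i$ such that $i$ occurs after $i+1$ in $\pi$. Call $\pi$ $(a,b)$-sandwiched ($a\ge0$, $b\ge1$ integers) if $\pi_i=i$ for $1\le i\le a$ and $\pi_{n-b+j}=a+j$ for $1\le j\le b$. If $\pi$ is $(a,b)$-sandwiched for some such $a,b$, then $\psi_q(\pi)=[a+b+1,1,2,\dots,a+1,\pi_{a+1}+1,\dots,\pi_{n-b}+1,a+2,\dots,a+b]$; otherwise $\psi_q(\pi)=\rho_{t+1,1}(\pi)=[t+1,\pi_1+\mathbb{1}_{\pi_1>t},\dots,\pi_n+\mathbb{1}_{\pi_n>t}]$.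 $\psi_r(\pi)=\rho_{1,n+1}(\pi)=[\pi_1+1,\dots,\pi_n+1,1]$, with domain the evil-avoiding $\pi\in S_n$, $n\ge1$. $\psi_s$, with domain $e_0$ together with the evil-avoiding $\pi\in S_n$ whose last $t$ entries are $1,2,\dots,t$ (in order) for some $t\ge1$: $\psi_s(\pi)=\rho_{t+1,n+1}(\pi)$, with $t=0$ for $e_0$. -}

module Defs where

open import Data.Nat using (ℕ; zero; suc; _+_; _∸_; _<?_; _≡ᵇ_; _≤ᵇ_; _≤_)
open import Data.Bool using (if_then_else_)
open import Data.List using (List; []; _∷_; _++_; map; filter; length; take; drop; applyUpTo)
open import Data.List.Membership.Propositional using (_∈_)
open import Data.List.Relation.Binary.Permutation.Propositional using (_↭_)
open import Relation.Nullary using (¬_)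
open import Relation.Binary.PropositionalEquality using (_≡_)
open import Data.Product using (_×_)
import Data.Sum

-- Permutations in one-line form: a list that is a rearrangement of [1,2,...,n].
Perm : Set
Perm = List ℕ

iden : ℕ → Perm
iden n = applyUpTo suc n

IsPerm : Perm → Set
IsPerm π = π ↭ iden (length π)

IsIdentity : Perm → Set
IsIdentity π = π ≡ iden (length π)

-- 0-based position of (the first occurrence of) x in π
pos : ℕ → List ℕ → ℕ
pos x [] = zero
pos x (y ∷ ys) = if x ≡ᵇ y then zero else suc (pos x ys)

recoilList : Perm → List ℕ
recoilList π = filter (λ i → pos (suc i) π <? pos i π) (applyUpTo suc (length π ∸ 1))

recoils : Perm → ℕ
recoils π = length (recoilList π)

-- least recoil (0 if there is none)
leastRecoil : Perm → ℕ
leastRecoil π with recoilList π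
... | [] = zero
... | i ∷ _ = i

-- pattern containment via subsequences and standardization
subseqs : List ℕ → List (List ℕ)
subseqs [] = [] ∷ []
subseqs (x ∷ xs) = map (x ∷_) (subseqs xs) ++ subseqs xs

std : List ℕ → List ℕ
std s = map (λ x → suc (length (filter (_<? x) s))) s

Contains : List ℕ → Perm → Set
Contains σ π = σ ∈ map std (subseqs π)

Avoids : List ℕ → Perm → Set
Avoids σ π = ¬ Contains σ π

EvilAvoiding : Perm → Set
EvilAvoiding π = Avoids (2 ∷ 4 ∷ 1 ∷ 3 ∷ []) π × Avoids (4 ∷ 1 ∷ 3 ∷ 2 ∷ []) π
               × Avoids (4 ∷ 2 ∷ 1 ∷ 3 ∷ []) π × Avoids (3 ∷ 2 ∷ 1 ∷ 4 ∷ []) π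

-- insert y so that it sits at 0-based index k
insertAt : ℕ → ℕ → List ℕ → List ℕ
insertAt k y xs = take k xs ++ y ∷ drop k xs

-- ρ_{i,j}: increase every entry ≥ i by 1, insert i at (1-based) position j
ρ : ℕ → ℕ → Perm → Perm
ρ i j π = insertAt (j ∸ 1) i (map (λ x → if i ≤ᵇ x then suc x else x) π)

ψp : Perm → Perm
ψp = ρ 1 1

ψr : Perm → Perm
ψr π = ρ 1 (suc (length π)) π

Sandwiched : ℕ → ℕ → Perm → Set
Sandwiched a b π = (1 ≤ b) × (take a π ≡ iden a)
                 × (drop (length π ∸ b) π ≡ applyUpTo (λ j → a + suc j) b)

-- ψ_q on an (a,b)-sandwiched π:
-- [a+b+1, 1, ..., a+1, π_{a+1}+1, ..., π_{n-b}+1, a+2, ..., a+b]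
ψqSand : ℕ → ℕ → Perm → Perm
ψqSand a b π = (a + b + 1) ∷ (iden (suc a)
  ++ map suc (take (length π ∸ b ∸ a) (drop a π))
  ++ applyUpTo (λ k → a + 2 + k) (b ∸ 1))

ψqGen : Perm → Perm
ψqGen π = ρ (suc (leastRecoil π)) 1 π

ψsT : ℕ → Perm → Perm
ψsT t π = ρ (suc t) (suc (length π)) π

SDomain : ℕ → Perm → Set
SDomain t π = (π ≡ [] × t ≡ 0)
  Data.Sum.⊎ ((1 ≤ t) × (drop (length π ∸ t) π ≡ iden t) × (t ≤ length π))

-- Each operator produces a permutation whose recoil sequence (the indicators of
-- "i+1 occurs before i", for i = 1, 2, ...) is that of π with exactly one bit
-- inserted.  For ρ_{i,1} and ρ_{i,n+1} this is because relabelling by the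
-- order-preserving shift and adding i at an end keeps every pair of consecutive
-- values not involving i in the same relative order; the bit at the new value
-- is read off from its extreme position.  A sandwiched π is I_a · M · J with
-- I_a = 1..a, J = a+1..a+b and all values of M above a+b; ψ_q(π) is
-- (a+b+1) · I_{a+1} · (M+1) · (a+2..a+b), and in both lists the values
-- 1..a+b appear in increasing order, the pair (a+b, a+b+1) is a recoil, and
-- the pairs of larger values are ordered as in M.
module Submission where

open import Defs
open import Data.Bool using (Bool; true; false; if_then_else_)
open import Data.Nat
open import Data.Nat.Properties
open import Algebra.Properties.CommutativeSemigroup +-commutativeSemigroup using (x∙yz≈y∙xz)
open import Data.List using (List; []; _∷_; _++_; map; filter; length; take; drop; applyUpTo)
open import Data.List.Properties
  using (length-map; length-++; take++drop≡id; drop-drop; take-all; drop-all; length-applyUpTo; ++-assoc; map-applyUpTo)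
open import Data.List.Membership.Propositional using (_∈_; _∉_)
open import Data.List.Membership.Propositional.Properties
  using (∈-++⁻; ∈-++⁺ˡ; ∈-++⁺ʳ; ∈-applyUpTo⁺; ∈-applyUpTo⁻; ∈-filter⁻; ∈-map⁺; ∈-map⁻)
open import Data.List.Membership.DecPropositional _≟_ using (_∈?_)
open import Data.List.Relation.Unary.Any using (here; there)
import Data.List.Relation.Unary.All as All
open import Data.List.Relation.Unary.AllPairs using (_∷_)
open import Data.List.Relation.Unary.Unique.Propositional using (Unique)
import Data.List.Relation.Unary.Unique.Propositional.Properties as Unique
open import Data.List.Relation.Binary.Permutation.Propositional using (↭-sym; ↭⇒↭ₛ)
open import Data.List.Relation.Binary.Permutation.Propositional.Properties using (∈-resp-↭)
import Data.List.Relation.Binary.Permutation.Setoid.Properties as PermutationSetoid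
open import Data.Product using (_×_; _,_; ∃₂; proj₂)
open import Data.Sum using (_⊎_; inj₁; inj₂)
open import Data.Empty using (⊥-elim)
open import Data.Unit using (tt)
open import Function using (_∘_)
open import Relation.Nullary using (¬_; yes; no; does)
open import Relation.Nullary.Decidable using (dec-true; dec-false)
open import Relation.Binary.PropositionalEquality hiding (J)

applyUpTo-cong : ∀ {A : Set} {f g : ℕ → A} n → (∀ j → f j ≡ g j) → applyUpTo f n ≡ applyUpTo g n
applyUpTo-cong zero eq = refl
applyUpTo-cong (suc n) eq = cong₂ _∷_ (eq 0) (applyUpTo-cong n (eq ∘ suc))

applyUpTo-++ : ∀ {A : Set} (f : ℕ → A) m n → applyUpTo f m ++ applyUpTo (f ∘ (m +_)) n ≡ applyUpTo f (m + n)
applyUpTo-++ f zero n = refl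
applyUpTo-++ f (suc m) n = cong (f 0 ∷_) (applyUpTo-++ (f ∘ suc) m n)

∈-++-∉ʳ : ∀ {A : Set} {x : A} xs {ys} → x ∈ xs ++ ys → x ∉ ys → x ∈ xs
∈-++-∉ʳ xs x∈ x∉ys with ∈-++⁻ xs x∈
... | inj₁ x∈xs = x∈xs
... | inj₂ x∈ys = ⊥-elim (x∉ys x∈ys)

Unique-++-disjoint : ∀ {A : Set} {x : A} xs ys → Unique (xs ++ ys) → x ∈ xs → x ∉ ys
Unique-++-disjoint (y ∷ xs) ys (y∉ ∷ _) (here refl) x∈ys = All.lookup y∉ (∈-++⁺ʳ xs x∈ys) refl
Unique-++-disjoint (y ∷ xs) ys (_ ∷ unique) (there x∈xs) = Unique-++-disjoint xs ys unique x∈xs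

Unique-++⁻ʳ : ∀ {A : Set} (xs : List A) {ys} → Unique (xs ++ ys) → Unique ys
Unique-++⁻ʳ [] unique = unique
Unique-++⁻ʳ (_ ∷ xs) (_ ∷ unique) = Unique-++⁻ʳ xs unique

head-drop∈take : ∀ {A : Set} {y : A} {ys} d m xs → drop d xs ≡ y ∷ ys → d < m → y ∈ take m xs
head-drop∈take zero (suc m) (x ∷ xs) refl _ = here refl
head-drop∈take (suc d) (suc m) (x ∷ xs) eq (s≤s d<m) = there (head-drop∈take d m xs eq d<m)

take-drop-split : ∀ {A : Set} m d (xs : List A) → m ≤ d →
  xs ≡ take m xs ++ take (d ∸ m) (drop m xs) ++ drop d xs
take-drop-split m d xs m≤d = begin
  xs                                                ≡⟨ sym (take++drop≡id m xs) ⟩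
  take m xs ++ drop m xs                            ≡⟨ cong (take m xs ++_) (sym (take++drop≡id (d ∸ m) ys)) ⟩
  take m xs ++ take (d ∸ m) ys ++ drop (d ∸ m) ys   ≡⟨ cong (λ zs → take m xs ++ take (d ∸ m) ys ++ zs) drop-ys ⟩
  take m xs ++ take (d ∸ m) ys ++ drop d xs         ∎
  where
  open ≡-Reasoning
  ys = drop m xs
  drop-ys : drop (d ∸ m) ys ≡ drop d xs
  drop-ys = trans (drop-drop m (d ∸ m) xs) (cong (λ e → drop e xs) (m+[n∸m]≡n m≤d))

fromBool : Bool → ℕ
fromBool true = 1
fromBool false = 0

countTrue : (ℕ → Bool) → ℕ → ℕ
countTrue b zero = 0
countTrue b (suc m) = fromBool (b 0) + countTrue (b ∘ suc) m

countTrue-cong : ∀ m {b c : ℕ → Bool} → (∀ j → j < m → b j ≡ c j) → countTrue b m ≡ countTrue c m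
countTrue-cong zero eq = refl
countTrue-cong (suc m) eq =
  cong₂ _+_ (cong fromBool (eq 0 z<s)) (countTrue-cong m (λ j j<m → eq (suc j) (s<s j<m)))

countTrue-insert : ∀ p m {b b′ : ℕ → Bool} v → p ≤ m →
  (∀ j → j < p → b′ j ≡ b j) → b′ p ≡ v → (∀ j → p ≤ j → j < m → b′ (suc j) ≡ b j) →
  countTrue b′ (suc m) ≡ fromBool v + countTrue b m
countTrue-insert zero m v _ _ at above =
  cong₂ _+_ (cong fromBool at) (countTrue-cong m (λ j j<m → above j z≤n j<m))
countTrue-insert (suc p) (suc m) {b} {b′} v (s≤s p≤m) below at above = begin
  fromBool (b′ 0) + countTrue (b′ ∘ suc) (suc m)     ≡⟨ cong₂ _+_ (cong fromBool (below 0 z<s)) rest ⟩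
  fromBool (b 0) + (fromBool v + countTrue (b ∘ suc) m) ≡⟨ x∙yz≈y∙xz (fromBool (b 0)) (fromBool v) _ ⟩
  fromBool v + (fromBool (b 0) + countTrue (b ∘ suc) m) ∎
  where
  open ≡-Reasoning
  rest = countTrue-insert p m v p≤m (λ j j<p → below (suc j) (s<s j<p)) at
           (λ j p≤j j<m → above (suc j) (s≤s p≤j) (s<s j<m))

isRecoil : Perm → ℕ → Bool
isRecoil π i = does (pos (suc i) π <? pos i π)

length-filter-recoil : ∀ π (f : ℕ → ℕ) m →
  length (filter (λ i → pos (suc i) π <? pos i π) (applyUpTo f m)) ≡ countTrue (isRecoil π ∘ f) m
length-filter-recoil π f zero = refl
length-filter-recoil π f (suc m) with does (pos (suc (f 0)) π <? pos (f 0) π)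
... | true = cong suc (length-filter-recoil π (f ∘ suc) m)
... | false = length-filter-recoil π (f ∘ suc) m

recoils≡countTrue : ∀ π → recoils π ≡ countTrue (isRecoil π ∘ suc) (length π ∸ 1)
recoils≡countTrue π = length-filter-recoil π suc (length π ∸ 1)

∈-recoilList⁻ : ∀ {i} π → i ∈ recoilList π → i < length π × isRecoil π i ≡ true
∈-recoilList⁻ {i} π@(_ ∷ _) i∈
  with ∈-filter⁻ (λ i → pos (suc i) π <? pos i π) {xs = applyUpTo suc (length π ∸ 1)} i∈
... | i∈range , recoil with ∈-applyUpTo⁻ suc i∈range
... | j , j<n , refl = s<s j<n , dec-true (pos (suc i) π <? pos i π) recoil

recoils-insert : ∀ σ π p v → length σ ≡ suc (length π) → 1 ≤ p → p ≤ length π →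
  (∀ k → 1 ≤ k → k < p → isRecoil σ k ≡ isRecoil π k) → isRecoil σ p ≡ v →
  (∀ k → p ≤ k → k < length π → isRecoil σ (suc k) ≡ isRecoil π k) →
  recoils σ ≡ fromBool v + recoils π
recoils-insert σ π (suc p) v length-σ _ p<n below at above = begin
  recoils σ                                     ≡⟨ recoils≡countTrue σ ⟩
  countTrue (isRecoil σ ∘ suc) (length σ ∸ 1)   ≡⟨ cong (λ l → countTrue (isRecoil σ ∘ suc) (l ∸ 1)) length-σ ⟩
  countTrue (isRecoil σ ∘ suc) (length π)       ≡⟨ cong (countTrue (isRecoil σ ∘ suc)) (sym n≡1+m) ⟩
  countTrue (isRecoil σ ∘ suc) (suc m)          ≡⟨ insert ⟩
  fromBool v + countTrue (isRecoil π ∘ suc) m   ≡⟨ cong (fromBool v +_) (sym (recoils≡countTrue π)) ⟩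
  fromBool v + recoils π                        ∎
  where
  open ≡-Reasoning
  m = length π ∸ 1
  n≡1+m : suc m ≡ length π
  n≡1+m = m+[n∸m]≡n (<-≤-trans z<s p<n)
  insert : countTrue (isRecoil σ ∘ suc) (suc m) ≡ fromBool v + countTrue (isRecoil π ∘ suc) m
  insert = countTrue-insert p m v (s≤s⁻¹ (subst (suc p ≤_) (sym n≡1+m) p<n))
    (λ j j<p → below (suc j) (s≤s z≤n) (s<s j<p)) at
    (λ j p≤j j<m → above (suc j) (s≤s p≤j) (subst (suc j <_) n≡1+m (s<s j<m)))

pos-head : ∀ x xs → pos x (x ∷ xs) ≡ 0
pos-head x xs with x ≡ᵇ x | ≡⇒≡ᵇ x x refl
... | true | _ = refl

pos-cons : ∀ {x y} xs → x ≢ y → pos x (y ∷ xs) ≡ suc (pos x xs)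
pos-cons {x} {y} xs x≢y with x ≡ᵇ y | ≡ᵇ⇒≡ x y
... | false | _ = refl
... | true | x≡y = ⊥-elim (x≢y (x≡y tt))

pos<length : ∀ {x} xs → x ∈ xs → pos x xs < length xs
pos<length {x} (y ∷ xs) x∈ with x ≟ y
... | yes refl = subst (_< suc (length xs)) (sym (pos-head x xs)) z<s
pos<length (y ∷ xs) (here refl) | no x≢y = ⊥-elim (x≢y refl)
pos<length (y ∷ xs) (there x∈) | no x≢y =
  subst (_< suc (length xs)) (sym (pos-cons xs x≢y)) (s<s (pos<length xs x∈))

pos-++-∈ : ∀ {x} A B → x ∈ A → pos x (A ++ B) ≡ pos x A
pos-++-∈ {x} (y ∷ A) B x∈ with x ≟ y
... | yes refl = trans (pos-head x (A ++ B)) (sym (pos-head x A))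
pos-++-∈ (y ∷ A) B (here refl) | no x≢y = ⊥-elim (x≢y refl)
pos-++-∈ (y ∷ A) B (there x∈) | no x≢y =
  trans (pos-cons (A ++ B) x≢y) (trans (cong suc (pos-++-∈ A B x∈)) (sym (pos-cons A x≢y)))

pos-++-∉ : ∀ {x} A B → x ∉ A → pos x (A ++ B) ≡ length A + pos x B
pos-++-∉ [] B x∉ = refl
pos-++-∉ (y ∷ A) B x∉ = trans (pos-cons (A ++ B) (x∉ ∘ here)) (cong suc (pos-++-∉ A B (x∉ ∘ there)))

pos-before : ∀ {x y} A B → x ∈ A → y ∉ A → pos x (A ++ B) < pos y (A ++ B)
pos-before A B x∈ y∉ = subst₂ _<_ (sym (pos-++-∈ A B x∈)) (sym (pos-++-∉ A B y∉))
  (<-≤-trans (pos<length A x∈) (m≤m+n (length A) _))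

pos-map : ∀ (f : ℕ → ℕ) {x} xs → (∀ {y} → f y ≡ f x → y ≡ x) → pos (f x) (map f xs) ≡ pos x xs
pos-map f [] _ = refl
pos-map f {x} (y ∷ xs) f-inj with x ≟ y
... | yes refl = trans (pos-head (f x) (map f xs)) (sym (pos-head x xs))
... | no x≢y = trans (pos-cons (map f xs) (λ fx≡fy → x≢y (sym (f-inj (sym fx≡fy)))))
                 (trans (cong suc (pos-map f xs f-inj)) (sym (pos-cons xs x≢y)))

isRecoil-true : ∀ σ k → pos (suc k) σ < pos k σ → isRecoil σ k ≡ true
isRecoil-true σ k = dec-true (pos (suc k) σ <? pos k σ)

isRecoil-false : ∀ σ k → pos k σ ≤ pos (suc k) σ → isRecoil σ k ≡ false
isRecoil-false σ k k≤ = dec-false (pos (suc k) σ <? pos k σ) (≤⇒≯ k≤)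

isRecoil-transfer : ∀ σ τ k l d → pos (suc k) σ ≡ d + pos (suc l) τ → pos k σ ≡ d + pos l τ →
  isRecoil σ k ≡ isRecoil τ l
isRecoil-transfer σ τ k l d eq₁ eq₂ with pos (suc l) τ <? pos l τ
... | yes lt = trans (isRecoil-true σ k (subst₂ _<_ (sym eq₁) (sym eq₂) (+-monoʳ-< d lt)))
                     (sym (isRecoil-true τ l lt))
... | no ¬lt = trans (isRecoil-false σ k (subst₂ _≤_ (sym eq₂) (sym eq₁) (+-monoʳ-≤ d (≮⇒≥ ¬lt))))
                     (sym (isRecoil-false τ l (≮⇒≥ ¬lt)))

isRecoil-head : ∀ k L → isRecoil (k ∷ L) k ≡ false
isRecoil-head k L = isRecoil-false (k ∷ L) k (subst (_≤ pos (suc k) (k ∷ L)) (sym (pos-head k L)) z≤n)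

isRecoil-head-suc : ∀ k L → isRecoil (suc k ∷ L) k ≡ true
isRecoil-head-suc k L = isRecoil-true (suc k ∷ L) k
  (subst₂ _<_ (sym (pos-head (suc k) L)) (sym (pos-cons L (<⇒≢ (n<1+n k)))) z<s)

isRecoil-∷ : ∀ {c k} L → suc k ≢ c → k ≢ c → isRecoil (c ∷ L) k ≡ isRecoil L k
isRecoil-∷ {c} {k} L sk≢c k≢c = isRecoil-transfer (c ∷ L) L k k 1 (pos-cons L sk≢c) (pos-cons L k≢c)

isRecoil-++ˡ : ∀ {k} A B → k ∈ A → suc k ∈ A → isRecoil (A ++ B) k ≡ isRecoil A k
isRecoil-++ˡ {k} A B k∈ sk∈ = isRecoil-transfer (A ++ B) A k k 0 (pos-++-∈ A B sk∈) (pos-++-∈ A B k∈)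

isRecoil-++-true : ∀ {k} A B → suc k ∈ A → k ∉ A → isRecoil (A ++ B) k ≡ true
isRecoil-++-true A B sk∈ k∉ = isRecoil-true (A ++ B) _ (pos-before A B sk∈ k∉)

isRecoil-++-false : ∀ {k} A B → k ∈ A → suc k ∉ A → isRecoil (A ++ B) k ≡ false
isRecoil-++-false A B k∈ sk∉ = isRecoil-false (A ++ B) _ (<⇒≤ (pos-before A B k∈ sk∉))

isRecoil-++ʳ : ∀ {k} A B → k ∉ A → suc k ∉ A → isRecoil (A ++ B) k ≡ isRecoil B k
isRecoil-++ʳ {k} A B k∉ sk∉ =
  isRecoil-transfer (A ++ B) B k k (length A) (pos-++-∉ A B sk∉) (pos-++-∉ A B k∉)

isRecoil-map : ∀ (f : ℕ → ℕ) L k → (∀ {x y} → f x ≡ f y → x ≡ y) → f (suc k) ≡ suc (f k) →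
  isRecoil (map f L) (f k) ≡ isRecoil L k
isRecoil-map f L k f-inj f-suc =
  isRecoil-transfer (map f L) L (f k) k 0
    (trans (cong (λ x → pos x (map f L)) (sym f-suc)) (pos-map f L f-inj)) (pos-map f L f-inj)

isRecoil-++-delete : ∀ {k} A M B → k ∉ M → suc k ∉ M → isRecoil (A ++ M ++ B) k ≡ isRecoil (A ++ B) k
isRecoil-++-delete {k} A M B k∉M sk∉M with k ∈? A | suc k ∈? A
... | yes k∈ | yes sk∈ = trans (isRecoil-++ˡ A (M ++ B) k∈ sk∈) (sym (isRecoil-++ˡ A B k∈ sk∈))
... | no k∉ | no sk∉ = trans (isRecoil-++ʳ A (M ++ B) k∉ sk∉)
                        (trans (isRecoil-++ʳ M B k∉M sk∉M) (sym (isRecoil-++ʳ A B k∉ sk∉)))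
... | yes k∈ | no sk∉ = trans (isRecoil-++-false A (M ++ B) k∈ sk∉) (sym (isRecoil-++-false A B k∈ sk∉))
... | no k∉ | yes sk∈ = trans (isRecoil-++-true A (M ++ B) sk∈ k∉) (sym (isRecoil-++-true A B sk∈ k∉))

∈-iden⁺ : ∀ {x n} → 1 ≤ x → x ≤ n → x ∈ iden n
∈-iden⁺ {suc x} _ x<n = ∈-applyUpTo⁺ suc x<n

∈-iden⁻ : ∀ {x n} → x ∈ iden n → 1 ≤ x × x ≤ n
∈-iden⁻ x∈ with ∈-applyUpTo⁻ suc x∈
... | _ , i<n , refl = s≤s z≤n , i<n

∉-iden : ∀ {x n} → n < x → x ∉ iden n
∉-iden n<x x∈ = <⇒≱ n<x (proj₂ (∈-iden⁻ x∈))

iden-suc : ∀ n → iden (suc n) ≡ 1 ∷ map suc (iden n)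
iden-suc n = cong (1 ∷_) (sym (map-applyUpTo suc suc n))

isRecoil-iden : ∀ n k → isRecoil (iden n) (suc k) ≡ false
isRecoil-iden zero k = refl
isRecoil-iden (suc n) zero = isRecoil-false (iden (suc n)) 1 z≤n
isRecoil-iden (suc n) (suc k) = begin
  isRecoil (iden (suc n)) (suc (suc k))           ≡⟨ cong (λ σ → isRecoil σ (suc (suc k))) (iden-suc n) ⟩
  isRecoil (1 ∷ map suc (iden n)) (suc (suc k))   ≡⟨ isRecoil-∷ {1} (map suc (iden n)) (λ ()) (λ ()) ⟩
  isRecoil (map suc (iden n)) (suc (suc k))       ≡⟨ isRecoil-map suc (iden n) (suc k) suc-injective refl ⟩
  isRecoil (iden n) (suc k)                       ≡⟨ isRecoil-iden n k ⟩
  false                                           ∎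
  where open ≡-Reasoning

iden-++ : ∀ a b {f : ℕ → ℕ} → (∀ j → f j ≡ suc (a + j)) → iden a ++ applyUpTo f b ≡ iden (a + b)
iden-++ a b eq = trans (cong (iden a ++_) (applyUpTo-cong b eq)) (applyUpTo-++ suc a b)

∈-perm : ∀ {π x} → IsPerm π → 1 ≤ x → x ≤ length π → x ∈ π
∈-perm perm 1≤x x≤n = ∈-resp-↭ (↭-sym perm) (∈-iden⁺ 1≤x x≤n)

perm-∈ : ∀ {π x} → IsPerm π → x ∈ π → 1 ≤ x × x ≤ length π
perm-∈ perm x∈ = ∈-iden⁻ (∈-resp-↭ perm x∈)

Unique-perm : ∀ {π} → IsPerm π → Unique π
Unique-perm {π} perm = PermutationSetoid.Unique-resp-↭ (setoid ℕ) (↭⇒↭ₛ (↭-sym perm))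
  (Unique.applyUpTo⁺₁ suc (length π) (λ i<j _ → <⇒≢ i<j ∘ suc-injective))

shift : ℕ → ℕ → ℕ
shift i x = if i ≤ᵇ x then suc x else x

shift-≥ : ∀ {i x} → i ≤ x → shift i x ≡ suc x
shift-≥ {i} {x} i≤x with i ≤ᵇ x | ≤⇒≤ᵇ i≤x
... | true | _ = refl

shift-< : ∀ {i x} → x < i → shift i x ≡ x
shift-< {i} {x} x<i with i ≤ᵇ x | ≤ᵇ⇒≤ i x
... | false | _ = refl
... | true | i≤x = ⊥-elim (<⇒≱ x<i (i≤x tt))

shift-≢ : ∀ {i} x → shift i x ≢ i
shift-≢ {i} x with i ≤? x
... | yes i≤x = λ eq → <⇒≢ (s≤s i≤x) (sym (trans (sym (shift-≥ i≤x)) eq))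
... | no i≰x = λ eq → <⇒≢ (≰⇒> i≰x) (trans (sym (shift-< (≰⇒> i≰x))) eq)

shift-<-≢-shift-≥ : ∀ {i x y} → x < i → i ≤ y → shift i x ≢ shift i y
shift-<-≢-shift-≥ x<i i≤y =
  <⇒≢ (subst₂ _<_ (sym (shift-< x<i)) (sym (shift-≥ i≤y)) (<-≤-trans x<i (m≤n⇒m≤1+n i≤y)))

shift-injective : ∀ {i x y} → shift i x ≡ shift i y → x ≡ y
shift-injective {i} {x} {y} eq with i ≤? x | i ≤? y
... | yes i≤x | yes i≤y = suc-injective (trans (sym (shift-≥ i≤x)) (trans eq (shift-≥ i≤y)))
... | no i≰x | no i≰y = trans (sym (shift-< (≰⇒> i≰x))) (trans eq (shift-< (≰⇒> i≰y)))
... | yes i≤x | no i≰y = ⊥-elim (shift-<-≢-shift-≥ (≰⇒> i≰y) i≤x (sym eq))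
... | no i≰x | yes i≤y = ⊥-elim (shift-<-≢-shift-≥ (≰⇒> i≰x) i≤y eq)

shift-suc : ∀ {i k} → suc k ≢ i → shift i (suc k) ≡ suc (shift i k)
shift-suc {i} {k} sk≢i with i ≤? k
... | yes i≤k = trans (shift-≥ (m≤n⇒m≤1+n i≤k)) (cong suc (sym (shift-≥ i≤k)))
... | no i≰k = trans (shift-< (≤∧≢⇒< (≰⇒> i≰k) sk≢i)) (cong suc (sym (shift-< (≰⇒> i≰k))))

shift-∉-map : ∀ i π → i ∉ map (shift i) π
shift-∉-map i π i∈ with ∈-map⁻ (shift i) i∈
... | x , _ , i≡shift = shift-≢ x (sym i≡shift)

length-insertAt : ∀ k y (xs : List ℕ) → length (insertAt k y xs) ≡ suc (length xs)
length-insertAt zero y xs = refl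
length-insertAt (suc k) y [] = refl
length-insertAt (suc k) y (x ∷ xs) = cong suc (length-insertAt k y xs)

length-ρ : ∀ i j π → length (ρ i j π) ≡ suc (length π)
length-ρ i j π = trans (length-insertAt (j ∸ 1) i _) (cong suc (length-map (shift i) π))

ρ-last : ∀ i π → ρ i (suc (length π)) π ≡ map (shift i) π ++ i ∷ []
ρ-last i π = cong₂ (λ xs ys → xs ++ i ∷ ys) (take-all (length π) _ n≥) (drop-all (length π) _ n≥)
  where
  n≥ : length π ≥ length (map (shift i) π)
  n≥ = ≤-reflexive (length-map (shift i) π)

isRecoil-ρ-front : ∀ {i k} π → suc k ≢ i → isRecoil (ρ i 1 π) (shift i k) ≡ isRecoil π k
isRecoil-ρ-front {i} {k} π sk≢i = trans
  (isRecoil-∷ (map (shift i) π) (subst (_≢ i) (shift-suc sk≢i) (shift-≢ (suc k))) (shift-≢ k))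
  (isRecoil-map (shift i) π k (shift-injective {i}) (shift-suc sk≢i))

isRecoil-ρ-last : ∀ {i k} π → suc k ≢ i → k ∈ π → suc k ∈ π →
  isRecoil (ρ i (suc (length π)) π) (shift i k) ≡ isRecoil π k
isRecoil-ρ-last {i} {k} π sk≢i k∈ sk∈ = begin
  isRecoil (ρ i (suc (length π)) π) (shift i k)  ≡⟨ cong (λ σ → isRecoil σ (shift i k)) (ρ-last i π) ⟩
  isRecoil (L ++ i ∷ []) (shift i k)             ≡⟨ isRecoil-++ˡ L (i ∷ []) (∈-map⁺ (shift i) k∈)
                                                      (subst (_∈ L) (shift-suc sk≢i) (∈-map⁺ (shift i) sk∈)) ⟩
  isRecoil L (shift i k)                         ≡⟨ isRecoil-map (shift i) π k (shift-injective {i}) (shift-suc sk≢i) ⟩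
  isRecoil π k                                   ∎
  where
  open ≡-Reasoning
  L = map (shift i) π

recoils-ρ-front : ∀ π t → t < length π → (1 ≤ t → isRecoil π t ≡ true) →
  recoils (ρ (suc t) 1 π) ≡ recoils π
recoils-ρ-front π t t<n t-recoil = recoils-insert σ π (suc t) false (length-ρ (suc t) 1 π) (s≤s z≤n) t<n
  below (isRecoil-head (suc t) (map (shift (suc t)) π)) above
  where
  σ = ρ (suc t) 1 π
  below : ∀ k → 1 ≤ k → k < suc t → isRecoil σ k ≡ isRecoil π k
  below k 1≤k k<1+t with m≤n⇒m<n∨m≡n (s≤s⁻¹ k<1+t)
  ... | inj₁ k<t = trans (cong (isRecoil σ) (sym (shift-< k<1+t))) (isRecoil-ρ-front π (<⇒≢ (s<s k<t)))
  ... | inj₂ refl = trans (isRecoil-head-suc k (map (shift (suc k)) π)) (sym (t-recoil 1≤k))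
  above : ∀ k → suc t ≤ k → k < length π → isRecoil σ (suc k) ≡ isRecoil π k
  above k t<k _ = trans (cong (isRecoil σ) (sym (shift-≥ t<k))) (isRecoil-ρ-front π (>⇒≢ (s<s t<k)))

leastRecoil-spec : ∀ π → leastRecoil π ≡ 0 ⊎ leastRecoil π ∈ recoilList π
leastRecoil-spec π with recoilList π
... | [] = inj₁ refl
... | i ∷ _ = inj₂ (here refl)

recoils-ψp : ∀ π → recoils (ψp π) ≡ recoils π
recoils-ψp [] = refl
recoils-ψp π@(_ ∷ _) = recoils-ρ-front π 0 z<s (λ ())

recoils-ψqGen : ∀ π → recoils (ψqGen π) ≡ recoils π
recoils-ψqGen π with leastRecoil-spec π
... | inj₁ t≡0 = subst (λ t → recoils (ρ (suc t) 1 π) ≡ recoils π) (sym t≡0) (recoils-ψp π)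
... | inj₂ t∈ with ∈-recoilList⁻ π t∈
...   | t<n , recoil = recoils-ρ-front π _ t<n (λ _ → recoil)

recoils-ψr : ∀ π → IsPerm π → 1 ≤ length π → recoils (ψr π) ≡ suc (recoils π)
recoils-ψr π perm 1≤n = recoils-insert (ψr π) π 1 true (length-ρ 1 (suc (length π)) π) (s≤s z≤n) 1≤n
  (λ k 1≤k k<1 → ⊥-elim (<⇒≱ k<1 1≤k)) at above
  where
  L = map (shift 1) π
  at : isRecoil (ψr π) 1 ≡ true
  at = trans (cong (λ σ → isRecoil σ 1) (ρ-last 1 π))
             (isRecoil-++-true L (1 ∷ []) (∈-map⁺ (shift 1) (∈-perm perm ≤-refl 1≤n)) (shift-∉-map 1 π))
  above : ∀ k → 1 ≤ k → k < length π → isRecoil (ψr π) (suc k) ≡ isRecoil π k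
  above k 1≤k k<n = trans (cong (isRecoil (ψr π)) (sym (shift-≥ 1≤k)))
    (isRecoil-ρ-last π (>⇒≢ (s<s 1≤k)) (∈-perm perm 1≤k (<⇒≤ k<n)) (∈-perm perm z<s k<n))

-- t+1 lies in front of the suffix 1..t.
isRecoil-iden-suffix : ∀ {π t} → IsPerm π → drop (length π ∸ t) π ≡ iden t → 1 ≤ t → t < length π →
  isRecoil π t ≡ true
isRecoil-iden-suffix {π} {t} perm suffix 1≤t t<n =
  subst (λ σ → isRecoil σ t ≡ true) (sym split) (isRecoil-++-true A (iden t) st∈A t∉A)
  where
  A = take (length π ∸ t) π
  split : π ≡ A ++ iden t
  split = trans (sym (take++drop≡id (length π ∸ t) π)) (cong (A ++_) suffix)
  st∈A : suc t ∈ A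
  st∈A = ∈-++-∉ʳ A (subst (suc t ∈_) split (∈-perm perm z<s t<n)) (∉-iden ≤-refl)
  t∉A : t ∉ A
  t∉A t∈A = Unique-++-disjoint A (iden t) (subst Unique split (Unique-perm perm)) t∈A (∈-iden⁺ 1≤t ≤-refl)

recoils-ψs : ∀ π t → IsPerm π → SDomain t π → recoils (ψsT t π) ≡ recoils π
recoils-ψs .[] .0 _ (inj₁ (refl , refl)) = refl
recoils-ψs π t perm (inj₂ (1≤t , suffix , t≤n)) =
  recoils-insert σ π t false (length-ρ (suc t) (suc (length π)) π) 1≤t t≤n below at above
  where
  σ = ψsT t π
  L = map (shift (suc t)) π
  σ≡ : σ ≡ L ++ suc t ∷ []
  σ≡ = ρ-last (suc t) π
  ∈π : ∀ {x} → 1 ≤ x → x ≤ length π → x ∈ π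
  ∈π = ∈-perm perm
  below : ∀ k → 1 ≤ k → k < t → isRecoil σ k ≡ isRecoil π k
  below k 1≤k k<t = trans (cong (isRecoil σ) (sym (shift-< (m<n⇒m<1+n k<t))))
    (isRecoil-ρ-last π (<⇒≢ (s<s k<t)) (∈π 1≤k (≤-trans (<⇒≤ k<t) t≤n)) (∈π z<s (≤-trans k<t t≤n)))
  at : isRecoil σ t ≡ false
  at = trans (cong (λ τ → isRecoil τ t) σ≡)
    (isRecoil-++-false L (suc t ∷ []) t∈L (shift-∉-map (suc t) π))
    where
    t∈L : t ∈ L
    t∈L = subst (_∈ L) (shift-< ≤-refl) (∈-map⁺ (shift (suc t)) (∈π 1≤t t≤n))
  above : ∀ k → t ≤ k → k < length π → isRecoil σ (suc k) ≡ isRecoil π k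
  above k t≤k k<n with m≤n⇒m<n∨m≡n t≤k
  ... | inj₁ t<k = trans (cong (isRecoil σ) (sym (shift-≥ t<k)))
    (isRecoil-ρ-last π (>⇒≢ (s<s t<k)) (∈π (≤-trans 1≤t t≤k) (<⇒≤ k<n)) (∈π z<s k<n))
  ... | inj₂ refl = trans (trans (cong (λ τ → isRecoil τ (suc t)) σ≡)
      (isRecoil-++-true L (suc t ∷ []) sst∈L (shift-∉-map (suc t) π)))
      (sym (isRecoil-iden-suffix perm suffix 1≤t k<n))
    where
    sst∈L : suc (suc t) ∈ L
    sst∈L = subst (_∈ L) (shift-≥ ≤-refl) (∈-map⁺ (shift (suc t)) (∈π z<s k<n))

module Sandwich (π : Perm) (a b′ : ℕ) (M : Perm)
  (split : π ≡ iden a ++ M ++ applyUpTo (λ j → a + suc j) (suc b′))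
  (perm : IsPerm π) (M-nonempty : 1 ≤ length M) where

  c : ℕ
  c = a + suc b′

  J J′ : List ℕ
  J = applyUpTo (λ j → a + suc j) (suc b′)
  J′ = applyUpTo (λ k → a + 2 + k) b′

  T N : Perm
  T = iden (suc a) ++ map suc M ++ J′
  N = (a + suc b′ + 1) ∷ T

  head-N : a + suc b′ + 1 ≡ suc c
  head-N = +-comm c 1

  ≢-head : ∀ {x} → x ≢ suc c → x ≢ a + suc b′ + 1
  ≢-head x≢1+c x≡ = x≢1+c (trans x≡ head-N)

  iden-++-J : iden a ++ J ≡ iden c
  iden-++-J = iden-++ a (suc b′) (+-suc a)

  iden-++-J′ : iden (suc a) ++ J′ ≡ iden c
  iden-++-J′ = trans (iden-++ (suc a) b′ {λ k → a + 2 + k} a+2+j≡) (cong iden (sym (+-suc a b′)))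
    where
    a+2+j≡ : ∀ j → a + 2 + j ≡ suc (suc a + j)
    a+2+j≡ j = trans (+-assoc a 2 j) (trans (+-suc a (suc j)) (cong suc (+-suc a j)))

  length-π : length π ≡ a + (length M + suc b′)
  length-π = trans (cong length split)
    (trans (length-++ (iden a)) (cong₂ _+_ (length-applyUpTo suc a)
      (trans (length-++ M) (cong (length M +_) (length-applyUpTo (λ j → a + suc j) (suc b′))))))

  c<n : c < length π
  c<n = subst (c <_) (sym length-π) (+-monoʳ-< a (+-monoˡ-≤ (suc b′) M-nonempty))

  unique : Unique (iden a ++ M ++ J)
  unique = subst Unique split (Unique-perm perm)

  M-large : ∀ {x} → x ∈ M → c < x
  M-large {x} x∈M with c <? x
  ... | yes c<x = c<x
  ... | no c≮x with ∈-++⁻ (iden a) (subst (x ∈_) (sym iden-++-J) (∈-iden⁺ 1≤x (≮⇒≥ c≮x)))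
    where
    1≤x : 1 ≤ x
    1≤x with perm-∈ perm (subst (x ∈_) (sym split) (∈-++⁺ʳ (iden a) (∈-++⁺ˡ x∈M)))
    ... | 1≤x , _ = 1≤x
  ... | inj₁ x∈I = ⊥-elim (Unique-++-disjoint (iden a) (M ++ J) unique x∈I (∈-++⁺ˡ x∈M))
  ... | inj₂ x∈J = ⊥-elim (Unique-++-disjoint M J (Unique-++⁻ʳ (iden a) {M ++ J} unique) x∈M x∈J)

  M-complete : ∀ {x} → c < x → x ≤ length π → x ∈ M
  M-complete {x} c<x x≤n with ∈-++⁻ (iden a) (subst (x ∈_) split (∈-perm perm (≤-trans z<s c<x) x≤n))
  ... | inj₁ x∈I = ⊥-elim (∉-iden (≤-<-trans (m≤m+n a (suc b′)) c<x) x∈I)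
  ... | inj₂ x∈MJ = ∈-++-∉ʳ M x∈MJ (λ x∈J → ∉-iden c<x (subst (x ∈_) iden-++-J (∈-++⁺ʳ (iden a) x∈J)))

  suc-M-large : ∀ {x} → x ∈ map suc M → suc c < x
  suc-M-large x∈ with ∈-map⁻ suc x∈
  ... | y , y∈M , refl = s<s (M-large y∈M)

  isRecoil-π-below : ∀ k → suc k < c → isRecoil π (suc k) ≡ false
  isRecoil-π-below k sk<c = begin
    isRecoil π (suc k)                     ≡⟨ cong (λ σ → isRecoil σ (suc k)) split ⟩
    isRecoil (iden a ++ M ++ J) (suc k)    ≡⟨ isRecoil-++-delete (iden a) M J (λ x∈ → <⇒≱ (M-large x∈) (<⇒≤ sk<c))
                                                (λ x∈ → <⇒≱ (M-large x∈) sk<c) ⟩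
    isRecoil (iden a ++ J) (suc k)         ≡⟨ cong (λ σ → isRecoil σ (suc k)) iden-++-J ⟩
    isRecoil (iden c) (suc k)              ≡⟨ isRecoil-iden c k ⟩
    false                                  ∎
    where open ≡-Reasoning

  isRecoil-N-below : ∀ k → suc k < c → isRecoil N (suc k) ≡ false
  isRecoil-N-below k sk<c = begin
    isRecoil N (suc k)                                  ≡⟨ isRecoil-∷ {a + suc b′ + 1} T
                                                             (≢-head (<⇒≢ (s<s sk<c))) (≢-head (<⇒≢ (m<n⇒m<1+n sk<c))) ⟩
    isRecoil (iden (suc a) ++ map suc M ++ J′) (suc k)  ≡⟨ isRecoil-++-delete (iden (suc a)) (map suc M) J′
                                                             (λ x∈ → <⇒≱ (suc-M-large x∈) (<⇒≤ (m<n⇒m<1+n sk<c)))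
                                                             (λ x∈ → <⇒≱ (suc-M-large x∈) (<⇒≤ (s<s sk<c))) ⟩
    isRecoil (iden (suc a) ++ J′) (suc k)               ≡⟨ cong (λ σ → isRecoil σ (suc k)) iden-++-J′ ⟩
    isRecoil (iden c) (suc k)                           ≡⟨ isRecoil-iden c k ⟩
    false                                               ∎
    where open ≡-Reasoning

  isRecoil-π-top : isRecoil π c ≡ true
  isRecoil-π-top = subst (λ σ → isRecoil σ c ≡ true) (sym (trans split (sym (++-assoc (iden a) M J))))
    (isRecoil-++-true (iden a ++ M) J sc∈ c∉)
    where
    sc∈ : suc c ∈ iden a ++ M
    sc∈ = ∈-++⁺ʳ (iden a) (M-complete ≤-refl c<n)
    c∉ : c ∉ iden a ++ M
    c∉ c∈ with ∈-++⁻ (iden a) c∈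
    ... | inj₁ c∈I = ∉-iden (m<m+n a z<s) c∈I
    ... | inj₂ c∈M = <-irrefl refl (M-large c∈M)

  isRecoil-N-top : isRecoil N c ≡ true
  isRecoil-N-top = subst (λ h → isRecoil (h ∷ T) c ≡ true) (sym head-N) (isRecoil-head-suc c T)

  isRecoil-N-new : isRecoil N (suc c) ≡ false
  isRecoil-N-new = subst (λ h → isRecoil (h ∷ T) (suc c) ≡ false) (sym head-N) (isRecoil-head (suc c) T)

  isRecoil-π-inside : ∀ k → c < k → k < length π → isRecoil π k ≡ isRecoil M k
  isRecoil-π-inside k c<k k<n = begin
    isRecoil π k                   ≡⟨ cong (λ σ → isRecoil σ k) split ⟩
    isRecoil (iden a ++ M ++ J) k  ≡⟨ isRecoil-++ʳ (iden a) (M ++ J) (∉-iden a<k) (∉-iden (m<n⇒m<1+n a<k)) ⟩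
    isRecoil (M ++ J) k            ≡⟨ isRecoil-++ˡ M J (M-complete c<k (<⇒≤ k<n)) (M-complete (m<n⇒m<1+n c<k) k<n) ⟩
    isRecoil M k                   ∎
    where
    open ≡-Reasoning
    a<k : a < k
    a<k = ≤-<-trans (m≤m+n a (suc b′)) c<k

  isRecoil-N-inside : ∀ k → c < k → k < length π → isRecoil N (suc k) ≡ isRecoil M k
  isRecoil-N-inside k c<k k<n = begin
    isRecoil N (suc k)                                  ≡⟨ isRecoil-∷ {a + suc b′ + 1} T
                                                             (≢-head (>⇒≢ (s<s (m<n⇒m<1+n c<k)))) (≢-head (>⇒≢ (s<s c<k))) ⟩
    isRecoil (iden (suc a) ++ map suc M ++ J′) (suc k)  ≡⟨ isRecoil-++ʳ (iden (suc a)) (map suc M ++ J′)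
                                                             (∉-iden (s<s a<k)) (∉-iden (s<s (m<n⇒m<1+n a<k))) ⟩
    isRecoil (map suc M ++ J′) (suc k)                  ≡⟨ isRecoil-++ˡ (map suc M) J′
                                                             (∈-map⁺ suc (M-complete c<k (<⇒≤ k<n)))
                                                             (∈-map⁺ suc (M-complete (m<n⇒m<1+n c<k) k<n)) ⟩
    isRecoil (map suc M) (suc k)                        ≡⟨ isRecoil-map suc M k suc-injective refl ⟩
    isRecoil M k                                        ∎
    where
    open ≡-Reasoning
    a<k : a < k
    a<k = ≤-<-trans (m≤m+n a (suc b′)) c<k

  recoils-N : recoils N ≡ recoils π
  recoils-N = recoils-insert N π (suc c) false length-N z<s c<n below isRecoil-N-new above
    where
    length-N : length N ≡ suc (length π)
    length-N = cong suc (trans (length-++ (iden (suc a)))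
      (trans (cong₂ _+_ (length-applyUpTo suc (suc a)) (trans (length-++ (map suc M))
        (cong₂ _+_ (length-map suc M) (length-applyUpTo (λ k → a + 2 + k) b′))))
      (sym (trans length-π (trans (cong (a +_) (+-suc (length M) b′)) (+-suc a _))))))
    below : ∀ k → 1 ≤ k → k < suc c → isRecoil N k ≡ isRecoil π k
    below (suc k) _ k<1+c with m≤n⇒m<n∨m≡n (s≤s⁻¹ k<1+c)
    ... | inj₁ sk<c = trans (isRecoil-N-below k sk<c) (sym (isRecoil-π-below k sk<c))
    ... | inj₂ sk≡c =
      subst (λ x → isRecoil N x ≡ isRecoil π x) (sym sk≡c) (trans isRecoil-N-top (sym isRecoil-π-top))
    above : ∀ k → suc c ≤ k → k < length π → isRecoil N (suc k) ≡ isRecoil π k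
    above k c<k k<n = trans (isRecoil-N-inside k c<k k<n) (sym (isRecoil-π-inside k c<k k<n))

recoils-ψqSand : ∀ π a b → IsPerm π → ¬ IsIdentity π → Sandwiched a b π → recoils (ψqSand a b π) ≡ recoils π
recoils-ψqSand π a zero _ _ (() , _)
recoils-ψqSand π a (suc b′) perm non-identity (_ , prefix , suffix) =
  Sandwich.recoils-N π a b′ M split perm M-nonempty
  where
  d = length π ∸ suc b′
  J = applyUpTo (λ j → a + suc j) (suc b′)
  M = take (d ∸ a) (drop a π)
  -- a ≤ d: otherwise the suffix value a+1 would lie in the prefix 1..a.
  a≤d : a ≤ d
  a≤d with d <? a
  ... | no d≮a = ≮⇒≥ d≮a
  ... | yes d<a = ⊥-elim (∉-iden (subst (a <_) (+-comm 1 a) ≤-refl)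
                    (subst ((a + 1) ∈_) prefix (head-drop∈take d a π suffix d<a)))
  split : π ≡ iden a ++ M ++ J
  split = trans (take-drop-split a d π a≤d) (cong₂ (λ A B → A ++ M ++ B) prefix suffix)
  M-nonempty : 1 ≤ length M
  M-nonempty with M in M≡
  ... | _ ∷ _ = s≤s z≤n
  ... | [] = ⊥-elim (non-identity (trans π≡iden (cong iden (sym length-π))))
    where
    π≡iden : π ≡ iden (a + suc b′)
    π≡iden = trans split (trans (cong (λ A → iden a ++ A ++ J) M≡) (iden-++ a (suc b′) (+-suc a)))
    length-π : length π ≡ a + suc b′
    length-π = trans (cong length π≡iden) (length-applyUpTo suc _)

mainTheorem10 :
    ((π : Perm) → IsPerm π → EvilAvoiding π → ¬ IsIdentity π →
      recoils (ψp π) ≡ recoils π)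
    × ((π : Perm) → IsPerm π → EvilAvoiding π → ¬ IsIdentity π →
      ((a b : ℕ) → Sandwiched a b π → recoils (ψqSand a b π) ≡ recoils π)
      × (¬ (∃₂ λ a b → Sandwiched a b π) → recoils (ψqGen π) ≡ recoils π))
    × ((π : Perm) → IsPerm π → EvilAvoiding π → 1 ≤ length π →
      recoils (ψr π) ≡ suc (recoils π))
    × ((π : Perm) (t : ℕ) → IsPerm π → EvilAvoiding π → SDomain t π →
      recoils (ψsT t π) ≡ recoils π)
mainTheorem10 =
  (λ π _ _ _ → recoils-ψp π) ,
  (λ π perm _ non-identity →
    (λ a b → recoils-ψqSand π a b perm non-identity) , (λ _ → recoils-ψqGen π)) ,
  (λ π perm _ → recoils-ψr π perm) ,
  (λ π t perm _ → recoils-ψs π t perm)
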